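{- Consider an instance $(D,B,\gamma)$ of the periodic aircraft routing problem with $\gamma \leq 4$. If the problem is feasible, then there exists an absolutely periodic solution.
   Context: An instance of the periodic aircraft routing problem consists of an Eulerian directed graph $D=(V,A)$ (parallel arcs allowed; every vertex has equal in- and outdegree), a subset $B \subseteq V$, and an integer $\gamma \geq 1$. Let $m=|A|$. A solution is a collection of $m$ semi-infinite walks $W_1,\ldots,W_m$ (walks with a first vertex and infinitely many subsequent arcs) such that (1) each walk visits $B$ infinitely many times, with at most $\gamma$ arcs between two visits, and (2) for every $j=1,2,\ldots$, the $j$th arcs of $W_1,\ldots,W_m$ are pairwise distinct and together form $A$. The problem is feasible if a solution exists. A solution is periodic if each $W_i$ is periodic. It is absolutely periodic if each $W_i$ is periodic and does not use the same arc twice within a period (so each $W_i$ repeatedly follows a fixed closed directed trail), and moreover every two walks $W_i$, $W_{i'}$ are either (arc-)disjoint or identical (follow the same closed directed trail). Equivalently, an absolutely periodic solution corresponds to a partition of $A$ into closed directed trails each visiting $B$ at least once every $\gamma$ arcs. -}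

module Defs where

open import Data.Nat using (ℕ; zero; suc; _+_; _≤_; _<_)
open import Data.Fin using (Fin)
open import Data.Fin.Properties using (_≟_)
open import Data.Fin.Subset using (Subset; _∈_)
open import Data.List using (List; length; filter; allFin)
open import Data.Product using (Σ; ∃; ∃-syntax; _×_)
open import Data.Sum using (_⊎_)
open import Relation.Nullary using (¬_)
open import Relation.Binary.PropositionalEquality using (_≡_; _≢_)
open import Function.Definitions using (Bijective)

record Digraph : Set where
  field
    n    : ℕ
    m    : ℕ
    tail : Fin m → Fin n
    head : Fin m → Fin n

open Digraph public

outdeg : (D : Digraph) → Fin (n D) → ℕ
outdeg D v = length (filter (λ a → tail D a ≟ v) (allFin (m D)))

indeg : (D : Digraph) → Fin (n D) → ℕ
indeg D v = length (filter (λ a → head D a ≟ v) (allFin (m D)))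

Eulerian : Digraph → Set
Eulerian D = ∀ v → indeg D v ≡ outdeg D v

IsWalk : (D : Digraph) → (ℕ → Fin (m D)) → Set
IsWalk D W = ∀ j → head D (W j) ≡ tail D (W (suc j))

vertexAt : (D : Digraph) → (ℕ → Fin (m D)) → ℕ → Fin (n D)
vertexAt D W zero    = tail D (W zero)
vertexAt D W (suc j) = head D (W j)

VisitsB : (D : Digraph) → Subset (n D) → ℕ → (ℕ → Fin (m D)) → Set
VisitsB D B γ W = ∀ i → ∃[ k ] (i < k × k ≤ i + γ × vertexAt D W k ∈ B)

IsSolution : (D : Digraph) → Subset (n D) → ℕ → (Fin (m D) → ℕ → Fin (m D)) → Set
IsSolution D B γ W =
  (∀ i → IsWalk D (W i) × VisitsB D B γ (W i)) ×
  (∀ j → Bijective _≡_ _≡_ (λ i → W i j))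

Feasible : (D : Digraph) → Subset (n D) → ℕ → Set
Feasible D B γ = ∃[ W ] IsSolution D B γ W

-- Periodic with period p ≥ 1, not using the same arc twice within a period
-- (so it repeatedly follows a fixed closed directed trail).
IsTrailPeriodic : {k : ℕ} → (ℕ → Fin k) → Set
IsTrailPeriodic w =
  ∃[ p ] (1 ≤ p × (∀ j → w (j + p) ≡ w j) ×
          (∀ j j′ → j < p → j′ < p → w j ≡ w j′ → j ≡ j′))

ArcDisjoint : {k : ℕ} → (ℕ → Fin k) → (ℕ → Fin k) → Set
ArcDisjoint w w′ = ∀ j j′ → w j ≢ w′ j′

-- Two walks follow the same closed directed trail: one is a time shift of
-- the other.
SameTrail : {k : ℕ} → (ℕ → Fin k) → (ℕ → Fin k) → Set
SameTrail w w′ = ∃[ s ] (∀ j → w′ j ≡ w (j + s))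

IsAbsolutelyPeriodic : (D : Digraph) → Subset (n D) → ℕ → (Fin (m D) → ℕ → Fin (m D)) → Set
IsAbsolutelyPeriodic D B γ W =
  IsSolution D B γ W ×
  (∀ i → IsTrailPeriodic (W i)) ×
  (∀ i i′ → ArcDisjoint (W i) (W i′) ⊎ SameTrail (W i) (W i′))

-- A solution determines, for every time j, a bijection next j of the arcs: the arc a walk
-- uses at time j goes to the arc the same walk uses at time j + 1, and next j e starts
-- where e ends.  Every bijection σ of the arcs with tail (σ e) = head e splits them into
-- closed trails, its orbits, and these form an absolutely periodic solution as soon as
-- every orbit meets B within γ steps.  Such a σ is spliced together from next 1 and
-- next 2.  An arc e is urgent when the walk carrying it at time 2 has avoided B at
-- positions 1, 2 and 3; since γ ≤ 4 that walk enters B right after e, so we keep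
-- σ e = next 2 e.  Every other arc follows next 1, rerouted along the tail-preserving
-- permutation next 1 ∘ (next 2)⁻¹ past the arcs already claimed by urgent arcs.  Now an
-- orbit whose heads avoid B three times in a row meets an urgent arc, hence enters B at
-- the next step, and each of these avoidances already forces γ to be correspondingly
-- large.

module Submission where

open import Defs
open import Data.Nat using (ℕ; zero; suc; _+_; _*_; _≤_; _<_; z≤n; s≤s; NonZero)
open import Data.Nat.Properties
open import Data.Nat.DivMod using (_%_; _/_; m≡m%n+[m/n]*n; m%n<n)
open import Data.Nat.GeneralisedArithmetic using (fold; fold-+)
open import Data.Fin using (Fin; toℕ; fromℕ<; punchOut)
import Data.Fin.Properties as Finₚ
open import Data.Fin.Subset using (Subset; _∈_; _∉_)
open import Data.Fin.Subset.Properties using (_∈?_)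
open import Data.Product using (∃; ∃-syntax; _×_; _,_; proj₁; proj₂)
open import Data.Sum using (_⊎_; inj₁; inj₂; [_,_]′)
open import Data.Empty using (⊥-elim)
open import Function.Base using (_∘_)
open import Function.Definitions using (Injective; Bijective)
open import Relation.Nullary using (¬_; Dec; yes; no; contradiction)
open import Relation.Nullary.Decidable using (_×-dec_; ¬?; decidable-stable)
open import Relation.Unary using (Decidable)
open import Relation.Binary.Definitions using (tri<; tri≈; tri>)
open import Relation.Binary.PropositionalEquality

module _ {P : ℕ → Set} (P? : Decidable P) where

  least-below : ∀ n → (∀ q → q < n → ¬ P q) ⊎ ∃[ p ] (P p × ∀ q → q < p → ¬ P q)
  least-below zero = inj₁ λ _ ()
  least-below (suc n) with least-below n | P? n
  ... | inj₂ least | _      = inj₂ least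
  ... | inj₁ none  | yes pn = inj₂ (n , pn , none)
  ... | inj₁ none  | no ¬pn = inj₁ none′
    where
    none′ : ∀ q → q < suc n → ¬ P q
    none′ q q<1+n with m<1+n⇒m<n∨m≡n q<1+n
    ... | inj₁ q<n  = none q q<n
    ... | inj₂ refl = ¬pn

  least-witness : ∀ {n} → P n → ∃[ p ] (P p × ∀ q → q < p → ¬ P q)
  least-witness {n} pn with least-below (suc n)
  ... | inj₂ least = least
  ... | inj₁ none  = contradiction pn (none n ≤-refl)

injective⇒surjective : ∀ {k} (f : Fin k → Fin k) → Injective _≡_ _≡_ f →
                       ∀ y → ∃ λ x → f x ≡ y
injective⇒surjective {suc k} f f-injective y with Finₚ.any? (λ x → f x Finₚ.≟ y)
... | yes hit = hit
... | no miss with Finₚ.pigeonhole (n<1+n k) (λ x → punchOut (λ eq → miss (x , sym eq)))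
...   | i , j , i<j , eq =
  contradiction (f-injective (Finₚ.punchOut-injective {i = y} (λ eq → miss (i , sym eq))
                                                              (λ eq → miss (j , sym eq)) eq))
                (Finₚ.<⇒≢ i<j)

module Orbits {k} (σ : Fin k → Fin k) (σ-injective : Injective _≡_ _≡_ σ) where

  orbit : Fin k → ℕ → Fin k
  orbit x j = fold x σ j

  orbit-+ : ∀ x a b → orbit x (a + b) ≡ orbit (orbit x b) a
  orbit-+ x a b = fold-+ x σ a

  orbit-suc : ∀ x a → orbit x (suc a) ≡ orbit (σ x) a
  orbit-suc x a = trans (cong (orbit x) (+-comm 1 a)) (orbit-+ x a 1)

  orbit-injective : ∀ j → Injective _≡_ _≡_ (λ x → orbit x j)
  orbit-injective zero    eq = eq
  orbit-injective (suc j) eq = orbit-injective j (σ-injective eq)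

  orbit-bijective : ∀ j → Bijective _≡_ _≡_ (λ x → orbit x j)
  orbit-bijective j = orbit-injective j , λ y →
    let x , eq = injective⇒surjective (λ x → orbit x j) (orbit-injective j) y
    in  x , λ { refl → eq }

  orbit-meet : ∀ x y {a b} → a < b → orbit x a ≡ orbit y b →
               ∃[ d ] (a + suc d ≡ b × x ≡ orbit y (suc d))
  orbit-meet x y {a} a<b eq with m≤n⇒∃[o]m+o≡n a<b
  ... | d , refl = d , +-suc a d , orbit-injective a (begin
    orbit x a                ≡⟨ eq ⟩
    orbit y (suc (a + d))    ≡⟨ cong (orbit y) (sym (+-suc a d)) ⟩
    orbit y (a + suc d)      ≡⟨ orbit-+ y a (suc d) ⟩
    orbit (orbit y (suc d)) a ∎)
    where open ≡-Reasoning

  orbit-returns : ∀ x → ∃[ q ] orbit x (suc q) ≡ x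
  orbit-returns x with Finₚ.pigeonhole (n<1+n k) (orbit x ∘ toℕ)
  ... | i , j , i<j , eq with orbit-meet x x i<j eq
  ...   | q , _ , x≡ = q , sym x≡

  orbit-period-* : ∀ x {P} → orbit x P ≡ x → ∀ n → orbit x (n * P) ≡ x
  orbit-period-* x     ret zero    = refl
  orbit-period-* x {P} ret (suc n) =
    trans (orbit-+ x P (n * P)) (trans (cong (λ z → orbit z P) (orbit-period-* x ret n)) ret)

  orbit-period-% : ∀ x P .{{_ : NonZero P}} → orbit x P ≡ x → ∀ n → orbit x (n % P) ≡ orbit x n
  orbit-period-% x P ret n = begin
    orbit x (n % P)                       ≡⟨ cong (λ z → orbit z (n % P)) (sym x↺) ⟩
    orbit (orbit x (n / P * P)) (n % P)   ≡⟨ sym (orbit-+ x (n % P) (n / P * P)) ⟩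
    orbit x (n % P + n / P * P)           ≡⟨ cong (orbit x) (sym (m≡m%n+[m/n]*n n P)) ⟩
    orbit x n                             ∎
    where
    open ≡-Reasoning
    x↺ : orbit x (n / P * P) ≡ x
    x↺ = orbit-period-* x ret (n / P)

  least-return : ∀ x → ∃[ p ] (orbit x (suc p) ≡ x × ∀ q → q < p → orbit x (suc q) ≢ x)
  least-return x = let q , ret = orbit-returns x in
    least-witness (λ q → orbit x (suc q) Finₚ.≟ x) {q} ret

  orbit-trailPeriodic : ∀ x → IsTrailPeriodic (orbit x)
  orbit-trailPeriodic x with least-return x
  ... | p , ret , least = suc p , s≤s z≤n , periodic , no-repeat
    where
    periodic : ∀ j → orbit x (j + suc p) ≡ orbit x j
    periodic j = trans (orbit-+ x j (suc p)) (cong (λ z → orbit z j) ret)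

    ordered : ∀ {j j′} → j < j′ → j′ < suc p → orbit x j ≢ orbit x j′
    ordered {j} j<j′ j′<1+p eq with orbit-meet x x j<j′ eq
    ... | d , j+1+d≡j′ , x≡ =
      least d (≤-trans (subst (suc d ≤_) j+1+d≡j′ (m≤n+m (suc d) j)) (≤-pred j′<1+p)) (sym x≡)

    no-repeat : ∀ j j′ → j < suc p → j′ < suc p → orbit x j ≡ orbit x j′ → j ≡ j′
    no-repeat j j′ j<1+p j′<1+p eq with <-cmp j j′
    ... | tri< j<j′ _ _ = contradiction eq (ordered j<j′ j′<1+p)
    ... | tri≈ _ j≡j′ _ = j≡j′
    ... | tri> _ _ j′<j = contradiction (sym eq) (ordered j′<j j<1+p)

  orbit-meet⇒reachable : ∀ x y {a b} → orbit x a ≡ orbit y b → ∃[ s ] orbit x s ≡ y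
  orbit-meet⇒reachable x y {a} {b} eq with orbit-returns y
  ... | q , ret = b * q + a , (begin
    orbit x (b * q + a)         ≡⟨ orbit-+ x (b * q) a ⟩
    orbit (orbit x a) (b * q)   ≡⟨ cong (λ z → orbit z (b * q)) eq ⟩
    orbit (orbit y b) (b * q)   ≡⟨ sym (orbit-+ y (b * q) b) ⟩
    orbit y (b * q + b)         ≡⟨ cong (orbit y) (trans (+-comm (b * q) b) (sym (*-suc b q))) ⟩
    orbit y (b * suc q)         ≡⟨ orbit-period-* y ret b ⟩
    y                           ∎)
    where open ≡-Reasoning

  orbits-disjoint-or-shifted : ∀ x y →
                               ArcDisjoint (orbit x) (orbit y) ⊎ SameTrail (orbit x) (orbit y)
  orbits-disjoint-or-shifted x y with orbit-returns x
  ... | p , ret with Finₚ.any? {n = suc p} (λ s → orbit x (toℕ s) Finₚ.≟ y)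
  ...   | yes (s , x↝y) = inj₂ (toℕ s , λ j →
            trans (cong (λ z → orbit z j) (sym x↝y)) (sym (orbit-+ x j (toℕ s))))
  ...   | no unreachable =
            inj₁ λ a b eq → unreachable (within-period (orbit-meet⇒reachable x y {a} {b} eq))
    where
    within-period : ∃[ s ] orbit x s ≡ y → ∃ λ (s : Fin (suc p)) → orbit x (toℕ s) ≡ y
    within-period (s , x↝y) = fromℕ< (m%n<n s (suc p)) ,
      trans (cong (orbit x) (Finₚ.toℕ-fromℕ< (m%n<n s (suc p))))
            (trans (orbit-period-% x (suc p) ret s) x↝y)

-- splice sends e ∈ Q to g e, and any other e to the first point of the ψ-orbit of f e
-- that is not of the form g e′ with e′ ∈ Q.  That orbit reaches g e itself, since
-- ψ (g e) = f e, so the search terminates.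
module Splice {k} (f g g⁻¹ : Fin k → Fin k) (f-injective : Injective _≡_ _≡_ f)
              (g⁻¹-inverseˡ : ∀ x → g⁻¹ (g x) ≡ x) (g⁻¹-inverseʳ : ∀ y → g (g⁻¹ y) ≡ y)
              {Q : Fin k → Set} (Q? : Decidable Q) where

  private
    ψ : Fin k → Fin k
    ψ = f ∘ g⁻¹

    ψ-injective : Injective _≡_ _≡_ ψ
    ψ-injective {y} {y′} eq =
      trans (sym (g⁻¹-inverseʳ y)) (trans (cong g (f-injective eq)) (g⁻¹-inverseʳ y′))

    open Orbits ψ ψ-injective

    Taken : Fin k → Set
    Taken y = Q (g⁻¹ y)

    taken-g : ∀ {e} → Q e → Taken (g e)
    taken-g {e} = subst Q (sym (g⁻¹-inverseˡ e))

    reaches-g : ∀ e → ∃[ q ] orbit (f e) q ≡ g e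
    reaches-g e with orbit-returns (g e)
    ... | q , ret = q , (begin
      orbit (f e) q           ≡⟨ cong (λ z → orbit (f z) q) (sym (g⁻¹-inverseˡ e)) ⟩
      orbit (ψ (g e)) q       ≡⟨ sym (orbit-suc (g e) q) ⟩
      orbit (g e) (suc q)     ≡⟨ ret ⟩
      g e                     ∎)
      where open ≡-Reasoning

    -- Opaque, so that the with-clauses below can abstract over exit e ¬q.
    opaque
      exit : ∀ e → ¬ Q e →
             ∃[ c ] (¬ Taken (orbit (f e) c) × ∀ j → j < c → Taken (orbit (f e) j))
      exit e ¬q =
        let q , f↝g          = reaches-g e
            c , free , taken = least-witness (λ c → ¬? (Q? (g⁻¹ (orbit (f e) c))))
                                 {q} (λ t → ¬q (subst Q (trans (cong g⁻¹ f↝g) (g⁻¹-inverseˡ e)) t))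
        in  c , free , λ j j<c → decidable-stable (Q? _) (taken j j<c)

    chains-disjoint : ∀ {e e′ c c′} → ¬ Q e → (∀ j → j < c′ → Taken (orbit (f e′) j)) →
                      c < c′ → orbit (f e) c ≢ orbit (f e′) c′
    chains-disjoint {e} {e′} {c} ¬q taken c<c′ eq with orbit-meet (f e) (f e′) c<c′ eq
    ... | d , c+1+d≡c′ , fe≡ =
      ¬q (subst Q (sym (f-injective fe≡)) (taken d (subst (suc d ≤_) c+1+d≡c′ (m≤n+m (suc d) c))))

  splice : Fin k → Fin k
  splice e with Q? e
  ... | yes _  = g e
  ... | no ¬q = orbit (f e) (proj₁ (exit e ¬q))

  splice-Q : ∀ {e} → Q e → splice e ≡ g e
  splice-Q {e} q with Q? e
  ... | yes _  = refl
  ... | no ¬q = contradiction q ¬q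

  splice-¬Q : ∀ {e} → ¬ Q e → ∃[ x ] (splice e ≡ f x × (x ≡ e ⊎ Q x))
  splice-¬Q {e} ¬q with Q? e
  ... | yes q = contradiction q ¬q
  ... | no ¬q with exit e ¬q
  ...   | zero  , _ , _     = e , refl , inj₁ refl
  ...   | suc c , _ , taken = g⁻¹ (orbit (f e) c) , refl , inj₂ (taken c ≤-refl)

  splice-colour : ∀ {C : Set} (κ : Fin k → C) → (∀ x → κ (f x) ≡ κ (g x)) →
                  ∀ e → κ (splice e) ≡ κ (f e)
  splice-colour κ κ-fg e with Q? e
  ... | yes _  = sym (κ-fg e)
  ... | no ¬q = κ-orbit (f e) (proj₁ (exit e ¬q))
    where
    κ-orbit : ∀ y c → κ (orbit y c) ≡ κ y
    κ-orbit y zero    = refl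
    κ-orbit y (suc c) =
      trans (κ-fg (g⁻¹ (orbit y c))) (trans (cong κ (g⁻¹-inverseʳ (orbit y c))) (κ-orbit y c))

  splice-injective : Injective _≡_ _≡_ splice
  splice-injective {e} {e′} eq with Q? e | Q? e′
  ... | yes _ | yes _ =
    trans (sym (g⁻¹-inverseˡ e)) (trans (cong g⁻¹ eq) (g⁻¹-inverseˡ e′))
  ... | yes q | no ¬q′ = ⊥-elim (proj₁ (proj₂ (exit e′ ¬q′)) (subst Taken eq (taken-g q)))
  ... | no ¬q | yes q′ = ⊥-elim (proj₁ (proj₂ (exit e ¬q)) (subst Taken (sym eq) (taken-g q′)))
  ... | no ¬q | no ¬q′ with exit e ¬q | exit e′ ¬q′
  ...   | c , _ , taken | c′ , _ , taken′ with <-cmp c c′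
  ...     | tri< c<c′ _ _ = ⊥-elim (chains-disjoint ¬q taken′ c<c′ eq)
  ...     | tri≈ _ refl _ = f-injective (orbit-injective c eq)
  ...     | tri> _ _ c′<c = ⊥-elim (chains-disjoint ¬q′ taken c′<c (sym eq))

module Transitions (D : Digraph) {W : Fin (m D) → ℕ → Fin (m D)}
                   (walks : ∀ i → IsWalk D (W i))
                   (simultaneous : ∀ j → Bijective _≡_ _≡_ (λ i → W i j)) where

  carrier : ℕ → Fin (m D) → Fin (m D)
  carrier j e = proj₁ (proj₂ (simultaneous j) e)

  carrier-spec : ∀ j e → W (carrier j e) j ≡ e
  carrier-spec j e = proj₂ (proj₂ (simultaneous j) e) refl

  carrier-W : ∀ j i → carrier j (W i j) ≡ i
  carrier-W j i = proj₁ (simultaneous j) (carrier-spec j (W i j))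

  next : ℕ → Fin (m D) → Fin (m D)
  next j e = W (carrier j e) (suc j)

  prev : ℕ → Fin (m D) → Fin (m D)
  prev j e = W (carrier (suc j) e) j

  prev-next : ∀ j e → prev j (next j e) ≡ e
  prev-next j e = trans (cong (λ i → W i j) (carrier-W (suc j) (carrier j e))) (carrier-spec j e)

  next-prev : ∀ j e → next j (prev j e) ≡ e
  next-prev j e =
    trans (cong (λ i → W i (suc j)) (carrier-W j (carrier (suc j) e))) (carrier-spec (suc j) e)

  next-injective : ∀ j → Injective _≡_ _≡_ (next j)
  next-injective j {e} {e′} eq =
    trans (sym (prev-next j e)) (trans (cong (prev j) eq) (prev-next j e′))

  tail-next : ∀ j e → tail D (next j e) ≡ head D e
  tail-next j e = trans (sym (walks (carrier j e) j)) (cong (head D) (carrier-spec j e))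

visit-after : ∀ {D B γ} {w : ℕ → Fin (m D)} → VisitsB D B γ w →
              ∀ r → (∀ k → k < r → head D (w k) ∉ B) → ∃[ k ] (r ≤ k × k < γ × head D (w k) ∈ B)
visit-after vis r avoid with vis 0
... | suc k , _ , k<γ , k∈B with k <? r
...   | yes k<r = contradiction k∈B (avoid k k<r)
...   | no k≮r = k , ≮⇒≥ k≮r , k<γ , k∈B

avoiding-prefix⇒< : ∀ {D B γ} {w : ℕ → Fin (m D)} → VisitsB D B γ w →
                    ∀ r → (∀ k → k < r → head D (w k) ∉ B) → r < γ
avoiding-prefix⇒< vis r avoid = let _ , r≤k , k<γ , _ = visit-after vis r avoid in ≤-<-trans r≤k k<γ

module Rerouting (D : Digraph) (B : Subset (n D)) (γ : ℕ) (1≤γ : 1 ≤ γ) (γ≤4 : γ ≤ 4)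
                 (W : Fin (m D) → ℕ → Fin (m D)) (sol : IsSolution D B γ W) where

  private
    walks : ∀ i → IsWalk D (W i)
    walks i = proj₁ (proj₁ sol i)

    visits : ∀ i → VisitsB D B γ (W i)
    visits i = proj₂ (proj₁ sol i)

  open Transitions D walks (proj₂ sol)

  Interior : Fin (m D) → Set
  Interior e = tail D e ∉ B × head D e ∉ B

  -- The walk carrying e at time 2 has avoided B at positions 1, 2 and 3.
  Urgent : Fin (m D) → Set
  Urgent e = Interior (prev 1 e) × Interior e

  Interior? : Decidable Interior
  Interior? e = ¬? (tail D e ∈? B) ×-dec ¬? (head D e ∈? B)

  Urgent? : Decidable Urgent
  Urgent? e = Interior? (prev 1 e) ×-dec Interior? e

  outside⇒1<γ : ∀ {e} → head D e ∉ B → 1 < γ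
  outside⇒1<γ {e} e∉B = avoiding-prefix⇒< (visits (carrier 0 e)) 1 λ where
    0 _ → e∉B ∘ subst (_∈ B) (cong (head D) (carrier-spec 0 e))
    (suc _) (s≤s ())

  interior⇒2<γ : ∀ {e} → Interior e → 2 < γ
  interior⇒2<γ {e} (t∉B , h∉B) = avoiding-prefix⇒< (visits (carrier 1 e)) 2 λ where
    0 _ → t∉B ∘ subst (_∈ B) (trans (walks (carrier 1 e) 0) (cong (tail D) (carrier-spec 1 e)))
    1 _ → h∉B ∘ subst (_∈ B) (cong (head D) (carrier-spec 1 e))
    (suc (suc _)) (s≤s (s≤s ()))

  urgent-avoids : ∀ {e} → Urgent e → ∀ k → k < 3 → head D (W (carrier 2 e) k) ∉ B
  urgent-avoids {e} ((t∉B , _) , _) 0 _ = t∉B ∘ subst (_∈ B) (walks (carrier 2 e) 0)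
  urgent-avoids ((_ , h∉B) , _)     1 _ = h∉B
  urgent-avoids {e} (_ , (_ , h∉B)) 2 _ = h∉B ∘ subst (_∈ B) (cong (head D) (carrier-spec 2 e))
  urgent-avoids _ (suc (suc (suc _))) (s≤s (s≤s (s≤s ())))

  urgent⇒3<γ : ∀ {e} → Urgent e → 3 < γ
  urgent⇒3<γ {e} u = avoiding-prefix⇒< (visits (carrier 2 e)) 3 (urgent-avoids u)

  urgent⇒next-in-B : ∀ {e} → Urgent e → head D (next 2 e) ∈ B
  urgent⇒next-in-B {e} u with visit-after (visits (carrier 2 e)) 3 (urgent-avoids u)
  ... | k , 3≤k , k<γ , k∈B with ≤-antisym (≤-pred (≤-trans k<γ γ≤4)) 3≤k
  ...   | refl = k∈B

  open Splice (next 1) (next 2) (prev 2) (next-injective 1) (prev-next 2) (next-prev 2) Urgent?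

  σ : Fin (m D) → Fin (m D)
  σ = splice

  tail-σ : ∀ e → tail D (σ e) ≡ head D e
  tail-σ e = trans (splice-colour (tail D) (λ x → trans (tail-next 1 x) (sym (tail-next 2 x))) e)
                   (tail-next 1 e)

  σ-interior : ∀ {e} → head D e ∉ B → head D (σ e) ∉ B → Interior (σ e)
  σ-interior {e} e∉B σe∉B = e∉B ∘ subst (_∈ B) (tail-σ e) , σe∉B

  urgent⇒σ-in-B : ∀ {e} → Urgent e → head D (σ e) ∈ B
  urgent⇒σ-in-B u = subst (λ a → head D a ∈ B) (sym (splice-Q u)) (urgent⇒next-in-B u)

  next₁-urgent : ∀ {x} → Interior x → head D (next 1 x) ∉ B → Urgent (next 1 x)
  next₁-urgent {x} int-x h∉B =
    subst Interior (sym (prev-next 1 x)) int-x , proj₂ int-x ∘ subst (_∈ B) (tail-next 1 x) , h∉B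

  σ-stays-interior⇒urgent : ∀ {e} → Interior e → head D (σ e) ∉ B → Urgent (σ e)
  σ-stays-interior⇒urgent {e} int σe∉B = from-decision (Urgent? e)
    where
    from-decision : Dec (Urgent e) → Urgent (σ e)
    from-decision (yes u) = contradiction (urgent⇒σ-in-B u) σe∉B
    from-decision (no ¬u) with splice-¬Q ¬u
    ... | x , σe≡ , x≡e⊎urgent =
      subst Urgent (sym σe≡) (next₁-urgent int-x (σe∉B ∘ subst (λ a → head D a ∈ B) (sym σe≡)))
      where
      int-x : Interior x
      int-x = [ (λ x≡e → subst Interior (sym x≡e) int) , proj₂ ]′ x≡e⊎urgent

  open Orbits σ splice-injective public

  orbit-enters-B : ∀ a → ∃[ t ] (t < γ × head D (orbit a t) ∈ B)
  orbit-enters-B a with head D a ∈? B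
  ... | yes a∈B = 0 , 1≤γ , a∈B
  ... | no a∉B with head D (σ a) ∈? B
  ...   | yes σa∈B = 1 , outside⇒1<γ a∉B , σa∈B
  ...   | no σa∉B with head D (σ (σ a)) ∈? B
  ...     | yes σ²a∈B = 2 , interior⇒2<γ (σ-interior a∉B σa∉B) , σ²a∈B
  ...     | no σ²a∉B  = 3 , urgent⇒3<γ u , urgent⇒σ-in-B u
    where
    u : Urgent (σ (σ a))
    u = σ-stays-interior⇒urgent (σ-interior a∉B σa∉B) σ²a∉B

  orbit-walk : ∀ a → IsWalk D (orbit a)
  orbit-walk a j = sym (tail-σ (orbit a j))

  orbit-visits : ∀ a → VisitsB D B γ (orbit a)
  orbit-visits a i with orbit-enters-B (orbit a i)
  ... | t , t<γ , t∈B =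
    suc (t + i) , s≤s (m≤n+m i t) ,
    subst (suc (t + i) ≤_) (+-comm γ i) (+-monoˡ-≤ i t<γ) ,
    subst (λ a → head D a ∈ B) (sym (orbit-+ a t i)) t∈B

  absolutely-periodic : IsAbsolutelyPeriodic D B γ orbit
  absolutely-periodic =
    ((λ a → orbit-walk a , orbit-visits a) , orbit-bijective) ,
    orbit-trailPeriodic , orbits-disjoint-or-shifted

theorem1p1 : (D : Digraph) → Eulerian D → (B : Subset (n D)) → (γ : ℕ) →
             1 ≤ γ → γ ≤ 4 → Feasible D B γ →
             ∃[ W ] IsAbsolutelyPeriodic D B γ W
theorem1p1 D _ B γ 1≤γ γ≤4 (W , sol) = orbit , absolutely-periodic
  where open Rerouting D B γ 1≤γ γ≤4 W sol
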